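{- Let $D=(V,A)$ be an oriented graph and let $v_0\in V$ be a vertex adjacent to all other vertices of $D$ (i.e. for every $u\in V\setminus\{v_0\}$, exactly one of $v_0u$, $uv_0$ is an arc). Let $a=\min\{d^+(v): v\in N^+(v_0)\}$ and $b=\min\{d^+(v): v\in N^-(v_0)\}$. If $d^+(v_0)\le \min\bigl(a,\tfrac12(a+b+1)\bigr)$, then $v_0$ belongs to $d^+(v_0)$ pairwise arc-disjoint (directed) cycles of $D$.
   Context: An oriented graph is a finite digraph without loops, multiple arcs, or pairs of opposite arcs. For a vertex $v$: $N^+(v)=\{u\in V\setminus\{v\}: vu\in A\}$, $N^-(v)=\{u\in V\setminus\{v\}: uv\in A\}$, and $d^+(v)=|N^+(v)|$. -}

module Defs where

open import Data.Nat using (ℕ; suc; _+_; _*_; _≤_)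
open import Data.Bool using (Bool; true; false)
open import Data.Fin using (Fin)
open import Data.List using (List; []; _∷_; length; filterᵇ; zip; _++_; [_])
open import Data.List.Relation.Unary.All using (All)
open import Data.List.Relation.Unary.Unique.Propositional using (Unique)
open import Data.List.Membership.Propositional using (_∈_; _∉_)
open import Data.Product using (_×_; _,_)
open import Data.Empty using (⊥)
open import Data.Sum using (_⊎_)
open import Relation.Binary.PropositionalEquality using (_≡_; _≢_)
open import Relation.Nullary using (¬_)
open import Data.List using (allFin)

Digraph : ℕ → Set
Digraph n = Fin n → Fin n → Bool

Arc : ∀ {n} → Digraph n → Fin n → Fin n → Set
Arc D u v = D u v ≡ true

record Oriented {n : ℕ} (D : Digraph n) : Set where
  field
    noLoop     : ∀ v → ¬ Arc D v v
    noOpposite : ∀ u v → Arc D u v → ¬ Arc D v u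

outdeg : ∀ {n} → Digraph n → Fin n → ℕ
outdeg {n} D v = length (filterᵇ (λ u → D v u) (allFin n))

-- v0 adjacent to every other vertex: for u ≠ v0, exactly one of v0u, uv0 is an arc
-- (at most one holds automatically in an oriented graph).
Dominating : ∀ {n} → Digraph n → Fin n → Set
Dominating D v0 = ∀ u → u ≢ v0 → Arc D v0 u ⊎ Arc D u v0

-- Arcs of the closed walk v0 → x1 → … → xk → v0, where xs = [x1,…,xk].
cycleArcs : ∀ {n} → Fin n → List (Fin n) → List (Fin n × Fin n)
cycleArcs v0 xs = zip (v0 ∷ xs) (xs ++ [ v0 ])

IsCycleThrough : ∀ {n} → Digraph n → Fin n → List (Fin n) → Set
IsCycleThrough D v0 [] = ⊥
IsCycleThrough D v0 xs@(_ ∷ _) =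
  Unique (v0 ∷ xs) × All (λ { (u , w) → Arc D u w }) (cycleArcs v0 xs)

record DisjointCyclesThrough {n : ℕ} (D : Digraph n) (v0 : Fin n) (k : ℕ) : Set where
  field
    cyc      : Fin k → List (Fin n)
    isCycle  : ∀ i → IsCycleThrough D v0 (cyc i)
    disjoint : ∀ i j → i ≢ j → ∀ e → e ∈ cycleArcs v0 (cyc i) → e ∉ cycleArcs v0 (cyc j)

module Submission where

-- Split v0 into a source keeping its out-arcs and a sink keeping its in-arcs.  Arc-disjoint
-- cycles through v0 are then unit flows from source to sink, and the augmenting-path proof of
-- max-flow/min-cut reduces the theorem to a bound on cuts.  A cut is given by the set R of
-- vertices other than v0 on the source side; its capacity is the number C of arcs leaving R
-- (towards v0 included) plus |N⁺(v0) ∖ R|, while k = d⁺(v0) = p + |N⁺(v0) ∖ R| with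
-- p = |R ∩ N⁺(v0)|.  So it suffices that p ≤ C.  Put q = |R ∩ N⁻(v0)|, so q ≤ C, and
-- m = |R| = p + q as v0 dominates.  The out-degrees over R add up to e + C, where e counts the
-- arcs inside R; the hypotheses on a and b, weighted by p and q, give k m ≤ e + C + q.
-- If C < p, then k m < e + m ≤ m (m + 1) / 2 ≤ k m, because m + 1 ≤ 2p ≤ 2k.

open import Defs
open import Data.Bool using (Bool; true; false; _∧_; _∨_; not)
open import Data.Bool.ListAction using (any; or)
open import Data.Bool.Properties
  using (∧-comm; ∧-assoc; ∧-zeroʳ; ∧-identityʳ; ∨-zeroʳ; ∧-conicalˡ; ∧-conicalʳ; ¬-not; T-≡)
open import Data.Empty using (⊥; ⊥-elim)
open import Data.Fin using (Fin; zero; suc)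
open import Data.Fin.Properties using (_≟_)
open import Data.List using (List; []; _∷_; length; filterᵇ; tabulate; zip; _++_; [_]; map; allFin)
open import Data.List.Membership.Propositional using (_∈_; _∉_)
open import Data.List.Membership.Propositional.Properties using (∈-allFin)
open import Data.List.Properties using (map-cong)
open import Data.List.Relation.Unary.All using (All; []; _∷_)
import Data.List.Relation.Unary.All as All
open import Data.List.Relation.Unary.All.Properties using (++⁺)
open import Data.List.Relation.Unary.AllPairs using ([]; _∷_)
import Data.List.Relation.Unary.AllPairs as AllPairs
open import Data.List.Relation.Unary.Any using (here; there; satisfied)
import Data.List.Relation.Unary.Any as Any
open import Data.List.Relation.Unary.Any.Properties using (any⁺; any⁻)
open import Data.List.Relation.Unary.Unique.Propositional using (Unique)
import Data.List.Relation.Unary.Unique.Propositional.Properties as Unique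
open import Data.Nat using (ℕ; zero; suc; _+_; _*_; _≤_; _<_; _≤?_; z≤n; s≤s; s≤s⁻¹; >-nonZero)
open import Data.Nat.Properties hiding (_≟_)
open import Algebra.Properties.CommutativeSemigroup +-commutativeSemigroup using (x∙yz≈y∙xz)
open import Algebra.Properties.Semiring.Sum +-*-semiring
  using (sum; ∑-distrib-+; ∑-comm; sum-cong-≗; *-distribˡ-sum; *-distribʳ-sum; sum-replicate-zero)
open import Data.Nat.Tactic.RingSolver using (solve-∀)
open import Data.Product using (_×_; _,_; proj₁; proj₂; ∃; map₂)
import Data.Product as Product
open import Data.Product.Properties using (≡-dec)
open import Data.Sum using (_⊎_; inj₁; inj₂)
open import Function using (_∘_; flip; case_of_; Equivalence)
open import Relation.Binary.PropositionalEquality hiding ([_])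
open import Relation.Nullary using (Dec; yes; no; does)
open import Relation.Nullary.Decidable using (dec-true; dec-false)

bool-clash : ∀ {b} → b ≡ true → b ≡ false → ⊥
bool-clash refl ()

∧-true : ∀ {a b} → a ∧ b ≡ true → a ≡ true × b ≡ true
∧-true h = ∧-conicalˡ _ _ h , ∧-conicalʳ _ _ h

∨-true : ∀ a {b} → a ∨ b ≡ true → a ≡ true ⊎ b ≡ true
∨-true true  _ = inj₁ refl
∨-true false h = inj₂ h

not≡true : ∀ {b} → not b ≡ true → b ≡ false
not≡true {false} _ = refl

∧-guarded-cong : ∀ a {b c} → (a ≡ true → b ≡ c) → a ∧ b ≡ a ∧ c
∧-guarded-cong true  b≡c = b≡c refl
∧-guarded-cong false _   = refl

∧-guarded-false : ∀ a {b} → (a ≡ true → b ≡ false) → a ∧ b ≡ false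
∧-guarded-false a a⇒¬b = trans (∧-guarded-cong a a⇒¬b) (∧-zeroʳ a)

≡true-ext : ∀ {a b} → (a ≡ true → b ≡ true) → (b ≡ true → a ≡ true) → a ≡ b
≡true-ext {true}          a⇒b _   = sym (a⇒b refl)
≡true-ext {false} {false} _   _   = refl
≡true-ext {false} {true}  _   b⇒a = b⇒a refl

𝟙 : Bool → ℕ
𝟙 true  = 1
𝟙 false = 0

𝟙≤1 : ∀ b → 𝟙 b ≤ 1
𝟙≤1 true  = ≤-refl
𝟙≤1 false = z≤n

𝟙-∧ : ∀ a b → 𝟙 (a ∧ b) ≡ 𝟙 a * 𝟙 b
𝟙-∧ true  b = sym (+-identityʳ (𝟙 b))
𝟙-∧ false b = refl

𝟙-mono : ∀ {a b} → (a ≡ true → b ≡ true) → 𝟙 a ≤ 𝟙 b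
𝟙-mono {false} _   = z≤n
𝟙-mono {true}  a⇒b rewrite a⇒b refl = ≤-refl

𝟙-injective : ∀ {a b} → 𝟙 a ≡ 𝟙 b → a ≡ b
𝟙-injective {true}  {true}  _ = refl
𝟙-injective {false} {false} _ = refl

𝟙*-mono : ∀ a {c c′} → (a ≡ true → c ≤ c′) → 𝟙 a * c ≤ 𝟙 a * c′
𝟙*-mono true  c≤c′ = *-monoʳ-≤ 1 (c≤c′ refl)
𝟙*-mono false _    = z≤n

𝟙-split : ∀ a b → 𝟙 b ≡ 𝟙 (a ∧ b) + 𝟙 (not a ∧ b)
𝟙-split true  b = sym (+-identityʳ (𝟙 b))
𝟙-split false b = refl

𝟙-split₃ : ∀ s t g → 𝟙 s * 𝟙 g ≡ 𝟙 (s ∧ t ∧ g) + 𝟙 (s ∧ not t ∧ g)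
𝟙-split₃ true  t g = trans (*-identityˡ (𝟙 g)) (𝟙-split t g)
𝟙-split₃ false t g = refl

𝟙-partition : ∀ a b c → (a ≡ true → b ∨ c ≡ true) → b ∧ c ≡ false →
              𝟙 a ≡ 𝟙 (a ∧ b) + 𝟙 (a ∧ c)
𝟙-partition false _     _     _ _ = refl
𝟙-partition true  true  false _ _ = refl
𝟙-partition true  false true  _ _ = refl
𝟙-partition true  false false covered _ with () ← covered refl

𝟙-disjoint-≤ : ∀ s t g h → g ∧ h ≡ false → 𝟙 (s ∧ t ∧ g) + 𝟙 (s ∧ t ∧ h) ≤ 𝟙 s * 𝟙 t
𝟙-disjoint-≤ false t     g     h     _ = z≤n
𝟙-disjoint-≤ true  false g     h     _ = z≤n
𝟙-disjoint-≤ true  true  true  false _ = ≤-refl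
𝟙-disjoint-≤ true  true  false h     _ = 𝟙≤1 h

𝟙-diagonal : ∀ s g → g ≡ false → 𝟙 (s ∧ s ∧ g) + 𝟙 (s ∧ s ∧ g) + 1 * 𝟙 s ≤ 𝟙 s * 𝟙 s
𝟙-diagonal true  false _ = ≤-refl
𝟙-diagonal false g     _ = ≤-refl

𝟙-remove : ∀ f a → (a ≡ true → f ≡ true) → 𝟙 (f ∧ not a) + 𝟙 a ≡ 𝟙 f
𝟙-remove f     false _ = trans (+-identityʳ _) (cong 𝟙 (∧-identityʳ f))
𝟙-remove true  true  _ = refl
𝟙-remove false true  a⇒f with () ← a⇒f refl

𝟙-reroute : ∀ f c p → (p ≡ true → f ≡ false) → 𝟙 ((f ∧ not c) ∨ p) + 𝟙 (c ∧ f) ≡ 𝟙 f + 𝟙 p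
𝟙-reroute true  true  false _ = refl
𝟙-reroute true  false false _ = refl
𝟙-reroute true  c     true  p⇒¬f with () ← p⇒¬f refl
𝟙-reroute false true  p     _ = +-identityʳ (𝟙 p)
𝟙-reroute false false p     _ = +-identityʳ (𝟙 p)

_==_ : ∀ {n} → Fin n → Fin n → Bool
x == y = does (x ≟ y)

==-refl : ∀ {n} (x : Fin n) → (x == x) ≡ true
==-refl x = dec-true (x ≟ x) refl

==-false : ∀ {n} {x y : Fin n} → x ≢ y → (x == y) ≡ false
==-false {x = x} {y} = dec-false (x ≟ y)

sum-mono-≤ : ∀ {n} {f g : Fin n → ℕ} → (∀ i → f i ≤ g i) → sum f ≤ sum g
sum-mono-≤ {zero}  _   = z≤n
sum-mono-≤ {suc n} f≤g = +-mono-≤ (f≤g zero) (sum-mono-≤ (f≤g ∘ suc))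

≤-sum : ∀ {n} (f : Fin n → ℕ) i → f i ≤ sum f
≤-sum f zero    = m≤m+n _ _
≤-sum f (suc i) = ≤-trans (≤-sum (f ∘ suc) i) (m≤n+m _ _)

sum-<-or-≗ : ∀ {n} {f g : Fin n → ℕ} → (∀ i → f i ≤ g i) → sum f < sum g ⊎ (∀ i → f i ≡ g i)
sum-<-or-≗ {zero}  _   = inj₂ λ ()
sum-<-or-≗ {suc n} f≤g with m≤n⇒m<n∨m≡n (f≤g zero) | sum-<-or-≗ (f≤g ∘ suc)
... | inj₁ head< | _          = inj₁ (+-mono-<-≤ head< (sum-mono-≤ (f≤g ∘ suc)))
... | inj₂ head≡ | inj₁ tail< = inj₁ (+-mono-≤-< (≤-reflexive head≡) tail<)
... | inj₂ head≡ | inj₂ tail≗ = inj₂ λ { zero → head≡ ; (suc i) → tail≗ i }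

sum-zero : ∀ {n} {f : Fin n → ℕ} → (∀ i → f i ≡ 0) → sum f ≡ 0
sum-zero {n} f≗0 = trans (sum-cong-≗ f≗0) (sum-replicate-zero n)

sum-+-≗ : ∀ {n} {f g h : Fin n → ℕ} → (∀ i → f i + g i ≡ h i) → sum f + sum g ≡ sum h
sum-+-≗ {f = f} {g} f+g≗h = trans (sym (∑-distrib-+ f g)) (sum-cong-≗ f+g≗h)

sum₂-distrib-+ : ∀ {n} (f g : Fin n → Fin n → ℕ) →
  sum (λ x → sum (λ y → f x y + g x y)) ≡ sum (λ x → sum (f x)) + sum (λ x → sum (g x))
sum₂-distrib-+ f g =
  trans (sum-cong-≗ λ x → ∑-distrib-+ (f x) (g x)) (∑-distrib-+ (λ x → sum (f x)) (λ x → sum (g x)))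

sum-product : ∀ {m n} (f : Fin m → ℕ) (g : Fin n → ℕ) →
              sum (λ x → sum (λ y → f x * g y)) ≡ sum f * sum g
sum-product f g = trans (sum-cong-≗ λ x → sym (*-distribˡ-sum (f x) g)) (sym (*-distribʳ-sum (sum g) f))

sum-point : ∀ {n} (x : Fin n) c → sum (λ y → 𝟙 (x == y) * c) ≡ c
sum-point {suc n} zero    c = trans (cong (c + 0 +_) (sum-zero {n} λ _ → refl)) (trans (+-identityʳ _) (+-identityʳ c))
sum-point {suc n} (suc x) c = sum-point x c

sum-𝟙≤ : ∀ {n} (b : Fin n → Bool) → sum (𝟙 ∘ b) ≤ n
sum-𝟙≤ {zero}  b = z≤n
sum-𝟙≤ {suc n} b = +-mono-≤ (𝟙≤1 (b zero)) (sum-𝟙≤ (b ∘ suc))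

sum-𝟙-pos : ∀ {n} (b : Fin n → Bool) → 1 ≤ sum (𝟙 ∘ b) → ∃ λ i → b i ≡ true
sum-𝟙-pos {suc n} b pos with b zero in b₀
... | true  = zero , b₀
... | false = Product.map suc (λ bi → bi) (sum-𝟙-pos (b ∘ suc) pos)

length-filterᵇ-tabulate : ∀ {n} {A : Set} (p : A → Bool) (f : Fin n → A) →
  length (filterᵇ p (tabulate f)) ≡ sum (λ i → 𝟙 (p (f i)))
length-filterᵇ-tabulate {zero}  p f = refl
length-filterᵇ-tabulate {suc n} p f with p (f zero)
... | true  = cong suc (length-filterᵇ-tabulate p (f ∘ suc))
... | false = length-filterᵇ-tabulate p (f ∘ suc)

any-allFin⁺ : ∀ {n} (p : Fin n → Bool) x → p x ≡ true → any p (allFin n) ≡ true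
any-allFin⁺ p x px =
  Equivalence.to T-≡ (any⁺ p (Any.map (λ { refl → Equivalence.from T-≡ px }) (∈-allFin x)))

any-allFin⁻ : ∀ {n} (p : Fin n → Bool) → any p (allFin n) ≡ true → ∃ λ x → p x ≡ true
any-allFin⁻ {n} p found =
  map₂ (Equivalence.to T-≡) (satisfied (any⁻ p (allFin n) (Equivalence.from T-≡ found)))

module _ {n : ℕ} where

  ArcOf : Digraph n → Fin n × Fin n → Set
  ArcOf G (u , w) = Arc G u w

  _⊆_ : Digraph n → Digraph n → Set
  G ⊆ H = ∀ {u w} → Arc G u w → Arc H u w

  deg⁺ : Digraph n → Fin n → ℕ
  deg⁺ G x = sum λ y → 𝟙 (G x y)

  deg⁻ : Digraph n → Fin n → ℕ
  deg⁻ G = deg⁺ (flip G)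

  ∣_∣ : (Fin n → Bool) → ℕ
  ∣ S ∣ = sum (𝟙 ∘ S)

  arcs : Digraph n → (S T : Fin n → Bool) → ℕ
  arcs G S T = sum λ x → sum λ y → 𝟙 (S x ∧ T y ∧ G x y)

  outdeg≡deg⁺ : ∀ G x → outdeg G x ≡ deg⁺ G x
  outdeg≡deg⁺ G x = length-filterᵇ-tabulate (G x) (λ y → y)

  arc≤arcs : ∀ G S T x y → 𝟙 (S x ∧ T y ∧ G x y) ≤ arcs G S T
  arc≤arcs G S T x y = ≤-trans (≤-sum (λ y′ → 𝟙 (S x ∧ T y′ ∧ G x y′)) y)
                               (≤-sum (λ x′ → sum λ y′ → 𝟙 (S x′ ∧ T y′ ∧ G x′ y′)) x)

  ∑-deg⁺-split : ∀ G S T → sum (λ x → 𝟙 (S x) * deg⁺ G x) ≡ arcs G S T + arcs G S (not ∘ T)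
  ∑-deg⁺-split G S T = trans (sum-cong-≗ split) (sum₂-distrib-+ into out-of)
    where
    into out-of : Fin n → Fin n → ℕ
    into   x y = 𝟙 (S x ∧ T y ∧ G x y)
    out-of x y = 𝟙 (S x ∧ not (T y) ∧ G x y)
    split : ∀ x → 𝟙 (S x) * deg⁺ G x ≡ sum (λ y → into x y + out-of x y)
    split x = trans (*-distribˡ-sum (𝟙 (S x)) (λ y → 𝟙 (G x y)))
                    (sum-cong-≗ λ y → 𝟙-split₃ (S x) (T y) (G x y))

  arcs-flip : ∀ G S T → arcs (flip G) S T ≡ arcs G T S
  arcs-flip G S T = trans (∑-comm (λ x y → 𝟙 (S x ∧ T y ∧ G y x)))
                          (sum-cong-≗ λ y → sum-cong-≗ λ x → cong 𝟙 (∧-swap (S x) (T y) (G y x)))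
    where
    ∧-swap : ∀ a b c → a ∧ b ∧ c ≡ b ∧ a ∧ c
    ∧-swap a b c = trans (sym (∧-assoc a b c)) (trans (cong (_∧ c) (∧-comm a b)) (∧-assoc b a c))

  ∑-deg⁻-split : ∀ G S T → sum (λ x → 𝟙 (S x) * deg⁻ G x) ≡ arcs G T S + arcs G (not ∘ T) S
  ∑-deg⁻-split G S T =
    trans (∑-deg⁺-split (flip G) S T) (cong₂ _+_ (arcs-flip G S T) (arcs-flip G S (not ∘ T)))

  module _ {G : Digraph n} (oriented : Oriented G) where

    oriented-loopless : ∀ x → G x x ≡ false
    oriented-loopless x = ¬-not (Oriented.noLoop oriented x)

    oriented-opposite : ∀ {y z} → Arc G z y → G y z ≡ false
    oriented-opposite {y} {z} Gzy = ¬-not λ Gyz → Oriented.noOpposite oriented y z Gyz Gzy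

    oriented-asym : ∀ x y → G x y ∧ G y x ≡ false
    oriented-asym x y = trans (∧-comm (G x y) (G y x)) (∧-guarded-false (G y x) oriented-opposite)

    arcs-inside-bound : ∀ S → 2 * arcs G S S + ∣ S ∣ ≤ ∣ S ∣ * ∣ S ∣
    arcs-inside-bound S = begin
      2 * e + ∣ S ∣
        ≡⟨ cong (_+ ∣ S ∣) (cong (e +_) (trans (+-identityʳ e) (sym (arcs-flip G S S)))) ⟩
      e + arcs (flip G) S S + ∣ S ∣
        ≡⟨ cong (e + arcs (flip G) S S +_) (sym (sum-cong-≗ λ x → sum-point x (𝟙 (S x)))) ⟩
      e + arcs (flip G) S S + sum (λ x → sum (diagonal x))
        ≡⟨ sym (trans (sum₂-distrib-+ (λ x y → forward x y + backward x y) diagonal)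
                      (cong (_+ sum (λ x → sum (diagonal x))) (sum₂-distrib-+ forward backward))) ⟩
      sum (λ x → sum (λ y → forward x y + backward x y + diagonal x y))
        ≤⟨ sum-mono-≤ (λ x → sum-mono-≤ (pair-bound x)) ⟩
      sum (λ x → sum (λ y → 𝟙 (S x) * 𝟙 (S y)))
        ≡⟨ sum-product (𝟙 ∘ S) (𝟙 ∘ S) ⟩
      ∣ S ∣ * ∣ S ∣ ∎
      where
      open ≤-Reasoning
      e : ℕ
      e = arcs G S S
      forward backward diagonal : Fin n → Fin n → ℕ
      forward  x y = 𝟙 (S x ∧ S y ∧ G x y)
      backward x y = 𝟙 (S x ∧ S y ∧ G y x)
      diagonal x y = 𝟙 (x == y) * 𝟙 (S x)
      pair-bound : ∀ x y → forward x y + backward x y + diagonal x y ≤ 𝟙 (S x) * 𝟙 (S y)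
      pair-bound x y with x ≟ y
      ... | yes refl = 𝟙-diagonal (S x) (G x x) (oriented-loopless x)
      ... | no  _    = ≤-trans (≤-reflexive (+-identityʳ _))
                               (𝟙-disjoint-≤ (S x) (S y) (G x y) (G y x) (oriented-asym x y))

module _ {n : ℕ} where

  open import Data.List.Membership.DecPropositional {A = Fin n × Fin n} (≡-dec _≟_ _≟_) using (_∈?_)

  pathArcs : Fin n → List (Fin n) → Fin n → List (Fin n × Fin n)
  pathArcs a xs b = zip (a ∷ xs) (xs ++ [ b ])

  map-proj₁-pathArcs : ∀ a xs b → map proj₁ (pathArcs a xs b) ≡ a ∷ xs
  map-proj₁-pathArcs a []       b = refl
  map-proj₁-pathArcs a (x ∷ xs) b = cong (a ∷_) (map-proj₁-pathArcs x xs b)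

  map-proj₂-pathArcs : ∀ a xs b → map proj₂ (pathArcs a xs b) ≡ xs ++ [ b ]
  map-proj₂-pathArcs a []       b = refl
  map-proj₂-pathArcs a (x ∷ xs) b = cong (x ∷_) (map-proj₂-pathArcs x xs b)

  pathArcs-snoc : ∀ a xs x b → pathArcs a (xs ++ [ x ]) b ≡ pathArcs a xs x ++ [ (x , b) ]
  pathArcs-snoc a []        x b = refl
  pathArcs-snoc a (x′ ∷ xs) x b = cong ((a , x′) ∷_) (pathArcs-snoc x′ xs x b)

  occurrences : Fin n → List (Fin n) → ℕ
  occurrences x []       = 0
  occurrences x (a ∷ as) = 𝟙 (a == x) + occurrences x as

  occurrences-snoc : ∀ x as b → occurrences x (as ++ [ b ]) ≡ occurrences x (b ∷ as)
  occurrences-snoc x []       b = refl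
  occurrences-snoc x (a ∷ as) b =
    trans (cong (𝟙 (a == x) +_) (occurrences-snoc x as b)) (x∙yz≈y∙xz (𝟙 (a == x)) (𝟙 (b == x)) _)

  occurrences-∉ : ∀ {x} as → All (x ≢_) as → occurrences x as ≡ 0
  occurrences-∉ []       []           = refl
  occurrences-∉ (a ∷ as) (x≢a ∷ x∉as) =
    cong₂ _+_ (cong 𝟙 (dec-false (a ≟ _) (x≢a ∘ sym))) (occurrences-∉ as x∉as)

  multiplicity : List (Fin n × Fin n) → Fin n → Fin n → ℕ
  multiplicity []            y z = 0
  multiplicity ((a , b) ∷ l) y z = 𝟙 (a == y ∧ b == z) + multiplicity l y z

  ∑-multiplicity-out : ∀ l x → sum (λ z → multiplicity l x z) ≡ occurrences x (map proj₁ l)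
  ∑-multiplicity-out []            x = sum-zero {n} λ _ → refl
  ∑-multiplicity-out ((a , b) ∷ l) x =
    trans (∑-distrib-+ (λ z → 𝟙 (a == x ∧ b == z)) (λ z → multiplicity l x z))
          (cong₂ _+_ (trans (sum-cong-≗ λ z → trans (𝟙-∧ (a == x) (b == z)) (*-comm (𝟙 (a == x)) _))
                            (sum-point b _))
                     (∑-multiplicity-out l x))

  ∑-multiplicity-in : ∀ l x → sum (λ y → multiplicity l y x) ≡ occurrences x (map proj₂ l)
  ∑-multiplicity-in []            x = sum-zero {n} λ _ → refl
  ∑-multiplicity-in ((a , b) ∷ l) x =
    trans (∑-distrib-+ (λ y → 𝟙 (a == y ∧ b == x)) (λ y → multiplicity l y x))
          (cong₂ _+_ (trans (sum-cong-≗ λ y → 𝟙-∧ (a == y) (b == x)) (sum-point a _))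
                     (∑-multiplicity-in l x))

  multiplicity-∉ : ∀ l {y} z → All (y ≢_) (map proj₁ l) → multiplicity l y z ≡ 0
  multiplicity-∉ []            z []           = refl
  multiplicity-∉ ((a , b) ∷ l) z (y≢a ∷ y∉l) =
    cong₂ _+_ (cong (λ c → 𝟙 (c ∧ b == z)) (dec-false (a ≟ _) (y≢a ∘ sym))) (multiplicity-∉ l z y∉l)

  multiplicity≤1 : ∀ l y z → Unique (map proj₁ l) → multiplicity l y z ≤ 1
  multiplicity≤1 []            y z _               = z≤n
  multiplicity≤1 ((a , b) ∷ l) y z (a∉l ∷ unique) with a ≟ y
  ... | yes refl rewrite multiplicity-∉ l z a∉l = ≤-trans (≤-reflexive (+-identityʳ _)) (𝟙≤1 (b == z))
  ... | no  _    = multiplicity≤1 l y z unique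

  ∈⇒multiplicity-pos : ∀ {l y z} → (y , z) ∈ l → 1 ≤ multiplicity l y z
  ∈⇒multiplicity-pos {(a , b) ∷ l} (here refl) rewrite ==-refl a | ==-refl b = s≤s z≤n
  ∈⇒multiplicity-pos {(a , b) ∷ l} (there e∈l) = ≤-trans (∈⇒multiplicity-pos e∈l) (m≤n+m _ _)

  multiplicity-pos⇒∈ : ∀ l {y z} → 1 ≤ multiplicity l y z → (y , z) ∈ l
  multiplicity-pos⇒∈ ((a , b) ∷ l) {y} {z} pos with a ≟ y | b ≟ z
  ... | yes refl | yes refl = here refl
  ... | yes _    | no  _    = there (multiplicity-pos⇒∈ l pos)
  ... | no  _    | _        = there (multiplicity-pos⇒∈ l pos)

  multiplicity≡𝟙∈ : ∀ l y z → Unique (map proj₁ l) → multiplicity l y z ≡ 𝟙 (does ((y , z) ∈? l))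
  multiplicity≡𝟙∈ l y z unique with (y , z) ∈? l
  ... | yes e∈l = ≤-antisym (multiplicity≤1 l y z unique) (∈⇒multiplicity-pos e∈l)
  ... | no  e∉l = n<1⇒n≡0 (≰⇒> (e∉l ∘ multiplicity-pos⇒∈ l))

  module _ (v0 : Fin n) where

    onCycle : List (Fin n) → Digraph n
    onCycle xs y z = does ((y , z) ∈? cycleArcs v0 xs)

    onCycle-sound : ∀ {xs y z} → onCycle xs y z ≡ true → (y , z) ∈ cycleArcs v0 xs
    onCycle-sound {xs} {y} {z} on with (y , z) ∈? cycleArcs v0 xs
    ... | yes e∈ = e∈

    onCycle-complete : ∀ {xs y z} → (y , z) ∈ cycleArcs v0 xs → onCycle xs y z ≡ true
    onCycle-complete {xs} {y} {z} = dec-true ((y , z) ∈? cycleArcs v0 xs)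

    module _ {xs : List (Fin n)} (unique : Unique (v0 ∷ xs)) where

      private
        tails-unique : Unique (map proj₁ (cycleArcs v0 xs))
        tails-unique = subst Unique (sym (map-proj₁-pathArcs v0 xs v0)) unique

        𝟙-onCycle : ∀ y z → 𝟙 (onCycle xs y z) ≡ multiplicity (cycleArcs v0 xs) y z
        𝟙-onCycle y z = sym (multiplicity≡𝟙∈ (cycleArcs v0 xs) y z tails-unique)

      -- Counted with multiplicity, the arcs of a closed walk enter and leave every vertex equally
      -- often; uniqueness of the vertices only serves to make these multiplicities 0 or 1.
      onCycle-balanced : ∀ x → deg⁻ (onCycle xs) x ≡ deg⁺ (onCycle xs) x
      onCycle-balanced x = begin
        sum (λ y → 𝟙 (onCycle xs y x))                   ≡⟨ sum-cong-≗ (λ y → 𝟙-onCycle y x) ⟩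
        sum (λ y → multiplicity (cycleArcs v0 xs) y x)   ≡⟨ ∑-multiplicity-in (cycleArcs v0 xs) x ⟩
        occurrences x (map proj₂ (cycleArcs v0 xs))      ≡⟨ cong (occurrences x) (map-proj₂-pathArcs v0 xs v0) ⟩
        occurrences x (xs ++ [ v0 ])                     ≡⟨ occurrences-snoc x xs v0 ⟩
        occurrences x (v0 ∷ xs)                          ≡⟨ cong (occurrences x) (map-proj₁-pathArcs v0 xs v0) ⟨
        occurrences x (map proj₁ (cycleArcs v0 xs))      ≡⟨ ∑-multiplicity-out (cycleArcs v0 xs) x ⟨
        sum (λ z → multiplicity (cycleArcs v0 xs) x z)   ≡⟨ sum-cong-≗ (λ z → 𝟙-onCycle x z) ⟨
        sum (λ z → 𝟙 (onCycle xs x z))                   ∎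
        where open ≡-Reasoning

      onCycle-deg⁺-v0 : deg⁺ (onCycle xs) v0 ≡ 1
      onCycle-deg⁺-v0 = begin
        sum (λ z → 𝟙 (onCycle xs v0 z))                  ≡⟨ sum-cong-≗ (𝟙-onCycle v0) ⟩
        sum (λ z → multiplicity (cycleArcs v0 xs) v0 z)  ≡⟨ ∑-multiplicity-out (cycleArcs v0 xs) v0 ⟩
        occurrences v0 (map proj₁ (cycleArcs v0 xs))     ≡⟨ cong (occurrences v0) (map-proj₁-pathArcs v0 xs v0) ⟩
        𝟙 (v0 == v0) + occurrences v0 xs
          ≡⟨ cong₂ _+_ (cong 𝟙 (==-refl v0)) (occurrences-∉ xs v0∉xs) ⟩
        1                                                ∎
        where
        open ≡-Reasoning
        v0∉xs : All (v0 ≢_) xs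
        v0∉xs = AllPairs.head unique

module _ {n : ℕ} {v0 : Fin n} where

  cycle-unique : ∀ {G : Digraph n} {xs} → IsCycleThrough G v0 xs → Unique (v0 ∷ xs)
  cycle-unique {xs = _ ∷ _} (unique , _) = unique

  cycle-arcs : ∀ {G : Digraph n} {xs} → IsCycleThrough G v0 xs → All (ArcOf G) (cycleArcs v0 xs)
  cycle-arcs {xs = _ ∷ _} (_ , along) = along

  onCycle⊆ : ∀ {G : Digraph n} {xs} → IsCycleThrough G v0 xs → onCycle v0 xs ⊆ G
  onCycle⊆ cycle on = All.lookup (cycle-arcs cycle) (onCycle-sound v0 on)

  cycle-mono : ∀ {G H : Digraph n} {xs} → G ⊆ H →
               IsCycleThrough G v0 xs → IsCycleThrough H v0 xs
  cycle-mono {xs = _ ∷ _} G⊆H (unique , along) = unique , All.map G⊆H along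

  no-cycles : ∀ {G : Digraph n} → DisjointCyclesThrough G v0 0
  no-cycles = record { cyc = λ () ; isCycle = λ () ; disjoint = λ () }

  disjoint-mono : ∀ {G H : Digraph n} {j} → G ⊆ H → DisjointCyclesThrough G v0 j → DisjointCyclesThrough H v0 j
  disjoint-mono G⊆H cycles = record
    { cyc = cyc ; isCycle = λ i → cycle-mono G⊆H (isCycle i) ; disjoint = disjoint }
    where open DisjointCyclesThrough cycles

  add-cycle : ∀ {G H : Digraph n} {xs j} → H ⊆ G → IsCycleThrough G v0 xs →
              (∀ {u w} → (u , w) ∈ cycleArcs v0 xs → H u w ≡ false) →
              DisjointCyclesThrough H v0 j → DisjointCyclesThrough G v0 (suc j)
  add-cycle {xs = xs} H⊆G cycle avoids cycles = record
    { cyc      = λ { zero → xs ; (suc i) → cyc i }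
    ; isCycle  = λ { zero → cycle ; (suc i) → cycle-mono H⊆G (isCycle i) }
    ; disjoint = λ
      { zero    zero    0≢0 → ⊥-elim (0≢0 refl)
      ; zero    (suc j) _   _ e∈ e∈′ → clash j e∈ e∈′
      ; (suc i) zero    _   _ e∈ e∈′ → clash i e∈′ e∈
      ; (suc i) (suc j) i≢j → disjoint i j (i≢j ∘ cong suc) }
    }
    where
    open DisjointCyclesThrough cycles
    clash : ∀ i {e} → e ∈ cycleArcs v0 xs → e ∈ cycleArcs v0 (cyc i) → ⊥
    clash i {u , w} e∈ e∈′ = bool-clash (All.lookup (cycle-arcs (isCycle i)) e∈′) (avoids e∈)

  cycle-snoc : ∀ {G : Digraph n} xs x → Unique (v0 ∷ xs ++ [ x ]) →
               All (ArcOf G) (pathArcs v0 xs x) → Arc G x v0 → IsCycleThrough G v0 (xs ++ [ x ])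
  cycle-snoc {G} xs x unique along closing = nonempty xs unique closed
    where
    closed : All (ArcOf G) (cycleArcs v0 (xs ++ [ x ]))
    closed = subst (All (ArcOf G)) (sym (pathArcs-snoc v0 xs x v0)) (++⁺ along (closing ∷ []))
    nonempty : ∀ ys → Unique (v0 ∷ ys ++ [ x ]) → All (ArcOf G) (cycleArcs v0 (ys ++ [ x ])) →
               IsCycleThrough G v0 (ys ++ [ x ])
    nonempty []      unique′ closed′ = unique′ , closed′
    nonempty (_ ∷ _) unique′ closed′ = unique′ , closed′

module Saturation {n : ℕ} (extend : (Fin n → Bool) → Fin n → Bool)
  (inflationary : ∀ S y → S y ≡ true → extend S y ≡ true)
  (extend-cong : ∀ {S T} → (∀ y → S y ≡ T y) → ∀ y → extend S y ≡ extend T y) where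

  stage : ℕ → Fin n → Bool
  stage zero    _ = false
  stage (suc m) = extend (stage m)

  Saturated : (Fin n → Bool) → Set
  Saturated S = ∀ y → extend S y ≡ S y

  private
    growth : ∀ m → m ≤ ∣ stage m ∣ ⊎ Saturated (stage m)
    growth zero    = inj₁ z≤n
    growth (suc m) with growth m
    ... | inj₂ saturated = inj₂ (extend-cong saturated)
    ... | inj₁ m≤size with sum-<-or-≗ (λ y → 𝟙-mono (inflationary (stage m) y))
    ...   | inj₁ grows = inj₁ (≤-<-trans m≤size grows)
    ...   | inj₂ same  = inj₂ (extend-cong λ y → sym (𝟙-injective (same y)))

  stage-saturated : Saturated (stage (suc n))
  stage-saturated with growth (suc n)
  ... | inj₁ n<size    = ⊥-elim (<⇒≱ n<size (sum-𝟙≤ (stage (suc n))))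
  ... | inj₂ saturated = saturated

-- v0 is never added to the reachable set: a path that returns to v0 closes a cycle.
module Reachability {n : ℕ} (G : Digraph n) (v0 : Fin n) where

  extend : (Fin n → Bool) → Fin n → Bool
  extend S y = S y ∨ (not (y == v0) ∧ (G v0 y ∨ any (λ x → S x ∧ G x y) (allFin n)))

  extend-inflationary : ∀ S y → S y ≡ true → extend S y ≡ true
  extend-inflationary S y Sy rewrite Sy = refl

  extend-cong : ∀ {S T} → (∀ y → S y ≡ T y) → ∀ y → extend S y ≡ extend T y
  extend-cong S≗T y = cong₂ (λ b c → b ∨ (not (y == v0) ∧ (G v0 y ∨ or c)))
                            (S≗T y) (map-cong (λ x → cong (_∧ G x y) (S≗T x)) (allFin n))

  open Saturation extend extend-inflationary extend-cong

  reachable : Fin n → Bool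
  reachable = stage (suc n)

  record PathTo (S : Fin n → Bool) (y : Fin n) : Set where
    field
      via    : List (Fin n)
      unique : Unique (v0 ∷ via ++ [ y ])
      along  : All (ArcOf G) (pathArcs v0 via y)
      inside : All (λ z → S z ≡ true) (via ++ [ y ])

  open PathTo

  private
    stage-v0 : ∀ m → stage m v0 ≡ false
    stage-v0 zero    = refl
    stage-v0 (suc m) rewrite stage-v0 m | ==-refl v0 = refl

    extend-root : ∀ S {y} → Arc G v0 y → y ≢ v0 → extend S y ≡ true
    extend-root S {y} Gv0y y≢v0 rewrite ==-false y≢v0 | Gv0y = ∨-zeroʳ (S y)

    extend-arc : ∀ S {x y} → S x ≡ true → Arc G x y → y ≢ v0 → extend S y ≡ true
    extend-arc S {x} {y} Sx Gxy y≢v0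
      rewrite ==-false y≢v0 | any-allFin⁺ (λ z → S z ∧ G z y) x (cong₂ _∧_ Sx Gxy) | ∨-zeroʳ (G v0 y)
      = ∨-zeroʳ (S y)

    extend-new : ∀ S {y} → S y ≡ false → extend S y ≡ true →
                 y ≢ v0 × (Arc G v0 y ⊎ ∃ λ x → S x ≡ true × Arc G x y)
    extend-new S {y} Sy new rewrite Sy with y ≟ v0 | G v0 y
    ... | no y≢v0 | true  = y≢v0 , inj₁ refl
    ... | no y≢v0 | false = y≢v0 , inj₂ (map₂ ∧-true (any-allFin⁻ (λ x → S x ∧ G x y) new))

    weaken : ∀ {S T y} → (∀ z → S z ≡ true → T z ≡ true) → PathTo S y → PathTo T y
    weaken S⊆T p = record
      { via = via p ; unique = unique p ; along = along p ; inside = All.map (S⊆T _) (inside p) }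

    root-path : ∀ {S y} → Arc G v0 y → y ≢ v0 → S y ≡ true → PathTo S y
    root-path Gv0y y≢v0 Sy = record
      { via = [] ; unique = ((y≢v0 ∘ sym) ∷ []) ∷ [] ∷ [] ; along = Gv0y ∷ [] ; inside = Sy ∷ [] }

    path-snoc : ∀ {S T x y} → (∀ z → S z ≡ true → T z ≡ true) → PathTo S x → Arc G x y →
                y ≢ v0 → S y ≡ false → T y ≡ true → PathTo T y
    path-snoc {x = x} {y} S⊆T p Gxy y≢v0 Sy Ty = record
      { via    = via p ++ [ x ]
      ; unique = Unique.++⁺ (unique p) ([] ∷ []) λ { (y∈ , here refl) → y∉ y∈ }
      ; along  = subst (All (ArcOf G)) (sym (pathArcs-snoc v0 (via p) x y)) (++⁺ (along p) (Gxy ∷ []))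
      ; inside = ++⁺ (All.map (S⊆T _) (inside p)) (Ty ∷ [])
      }
      where
      y∉ : y ∉ v0 ∷ via p ++ [ x ]
      y∉ (here y≡v0) = y≢v0 y≡v0
      y∉ (there y∈)  = bool-clash (All.lookup (inside p) y∈) Sy

    path : ∀ m {y} → stage m y ≡ true → PathTo (stage m) y
    path (suc m) {y} y∈ = old-or-new (stage m y) refl
      where
      old-or-new : ∀ b → stage m y ≡ b → PathTo (stage (suc m)) y
      old-or-new true  old = weaken (extend-inflationary (stage m)) (path m old)
      old-or-new false new with extend-new (stage m) new y∈
      ... | y≢v0 , inj₁ Gv0y            = root-path Gv0y y≢v0 y∈
      ... | y≢v0 , inj₂ (x , x∈ , Gxy) = path-snoc (extend-inflationary (stage m)) (path m x∈) Gxy y≢v0 new y∈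

  reachable-v0 : reachable v0 ≡ false
  reachable-v0 = stage-v0 (suc n)

  reachable-≢v0 : ∀ {y} → reachable y ≡ true → y ≢ v0
  reachable-≢v0 Ry refl = bool-clash Ry reachable-v0

  reachable-root : ∀ {y} → Arc G v0 y → y ≢ v0 → reachable y ≡ true
  reachable-root Gv0y y≢v0 = trans (sym (stage-saturated _)) (extend-root reachable Gv0y y≢v0)

  reachable-arc : ∀ {x y} → reachable x ≡ true → Arc G x y → y ≢ v0 → reachable y ≡ true
  reachable-arc Rx Gxy y≢v0 = trans (sym (stage-saturated _)) (extend-arc reachable Rx Gxy y≢v0)

  cycle-or-closed : (∃ λ xs → IsCycleThrough G v0 xs) ⊎ (∀ x → reachable x ≡ true → Arc G x v0 → ⊥)
  cycle-or-closed with any (λ x → reachable x ∧ G x v0) (allFin n) in found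
  ... | true  with any-allFin⁻ (λ x → reachable x ∧ G x v0) found
  ...   | x , Rx∧Gxv0 with ∧-true Rx∧Gxv0
  ...     | Rx , Gxv0 = let p = path (suc n) Rx in inj₁ (_ , cycle-snoc (via p) x (unique p) (along p) Gxv0)
  cycle-or-closed | false = inj₂ λ x Rx Gxv0 →
    bool-clash (any-allFin⁺ (λ z → reachable z ∧ G z v0) x (cong₂ _∧_ Rx Gxv0)) found

rebalance : ∀ {a₁ a₂ c₁ c₂ f₁ f₂ p₁ p₂ r₁ r₂ : ℕ} →
  a₁ + c₁ ≡ f₁ + p₁ → a₂ + c₂ ≡ f₂ + p₂ → r₁ ≡ p₁ + c₂ → r₂ ≡ p₂ + c₁ → f₁ ≡ f₂ → r₁ ≡ r₂ → a₁ ≡ a₂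
rebalance {a₁} {a₂} {c₁} {c₂} {f₁} {f₂} {p₁} {p₂} {r₁} {r₂} e₁ e₂ d₁ d₂ f₁≡f₂ r₁≡r₂ =
  +-cancelʳ-≡ (c₁ + c₂) a₁ a₂ (begin
    a₁ + (c₁ + c₂)    ≡⟨ +-assoc a₁ c₁ c₂ ⟨
    a₁ + c₁ + c₂      ≡⟨ cong (_+ c₂) e₁ ⟩
    f₁ + p₁ + c₂      ≡⟨ +-assoc f₁ p₁ c₂ ⟩
    f₁ + (p₁ + c₂)    ≡⟨ cong₂ _+_ f₁≡f₂ (trans (sym d₁) (trans r₁≡r₂ d₂)) ⟩
    f₂ + (p₂ + c₁)    ≡⟨ +-assoc f₂ p₂ c₁ ⟨
    f₂ + p₂ + c₁      ≡⟨ cong (_+ c₁) e₂ ⟨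
    a₂ + c₂ + c₁      ≡⟨ +-assoc a₂ c₂ c₁ ⟩
    a₂ + (c₂ + c₁)    ≡⟨ cong (a₂ +_) (+-comm c₂ c₁) ⟩
    a₂ + (c₁ + c₂)    ∎)
  where open ≡-Reasoning

module Flows {n : ℕ} (D : Digraph n) (v0 : Fin n) (oriented : Oriented D) where

  record IsFlow (F : Digraph n) : Set where
    field
      F⊆D       : F ⊆ D
      conserved : ∀ x → x ≢ v0 → deg⁻ F x ≡ deg⁺ F x

  open IsFlow

  empty-isFlow : IsFlow (λ _ _ → false)
  empty-isFlow = record { F⊆D = λ () ; conserved = λ _ _ → refl }

  flow-cut : ∀ {F} → IsFlow F → ∀ S → S v0 ≡ false → arcs F (not ∘ S) S ≡ arcs F S (not ∘ S)
  flow-cut {F} flow S Sv0 = +-cancelˡ-≡ (arcs F S S) _ _ (begin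
      arcs F S S + arcs F (not ∘ S) S   ≡⟨ ∑-deg⁻-split F S S ⟨
      sum (λ x → 𝟙 (S x) * deg⁻ F x)    ≡⟨ sum-cong-≗ weighted ⟩
      sum (λ x → 𝟙 (S x) * deg⁺ F x)    ≡⟨ ∑-deg⁺-split F S S ⟩
      arcs F S S + arcs F S (not ∘ S)   ∎)
    where
    open ≡-Reasoning
    weighted : ∀ x → 𝟙 (S x) * deg⁻ F x ≡ 𝟙 (S x) * deg⁺ F x
    weighted x with S x in Sx
    ... | false = refl
    ... | true  = cong (1 *_) (conserved flow x λ { refl → bool-clash Sx Sv0 })

  module Removal {F C : Digraph n} (flow : IsFlow F) (C⊆F : C ⊆ F)
                 (C-balanced : ∀ x → deg⁻ C x ≡ deg⁺ C x) (C-v0 : deg⁺ C v0 ≡ 1) where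

    remove : Digraph n
    remove y z = F y z ∧ not (C y z)

    private
      pointwise : ∀ y z → 𝟙 (remove y z) + 𝟙 (C y z) ≡ 𝟙 (F y z)
      pointwise y z = 𝟙-remove (F y z) (C y z) C⊆F

      deg⁺-remove : ∀ x → deg⁺ remove x + deg⁺ C x ≡ deg⁺ F x
      deg⁺-remove x = sum-+-≗ (pointwise x)

      deg⁻-remove : ∀ x → deg⁻ remove x + deg⁻ C x ≡ deg⁻ F x
      deg⁻-remove x = sum-+-≗ (λ y → pointwise y x)

    remove⊆F : remove ⊆ F
    remove⊆F h = proj₁ (∧-true h)

    remove-isFlow : IsFlow remove
    remove-isFlow = record
      { F⊆D       = λ h → F⊆D flow (remove⊆F h)
      ; conserved = λ x x≢v0 → +-cancelʳ-≡ (deg⁺ C x) _ _ (begin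
          deg⁻ remove x + deg⁺ C x   ≡⟨ cong (deg⁻ remove x +_) (C-balanced x) ⟨
          deg⁻ remove x + deg⁻ C x   ≡⟨ deg⁻-remove x ⟩
          deg⁻ F x                   ≡⟨ conserved flow x x≢v0 ⟩
          deg⁺ F x                   ≡⟨ deg⁺-remove x ⟨
          deg⁺ remove x + deg⁺ C x   ∎)
      }
      where open ≡-Reasoning

    remove-value : deg⁺ F v0 ≡ suc (deg⁺ remove v0)
    remove-value = trans (sym (deg⁺-remove v0)) (trans (cong (deg⁺ remove v0 +_) C-v0) (+-comm _ 1))

    removed : ∀ {u w} → Arc C u w → remove u w ≡ false
    removed {u} {w} Cuw rewrite Cuw = ∧-zeroʳ (F u w)

  -- Flow on an arc at v0 is never cancelled: v0 is the source for its out-arcs and the sink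
  -- for its in-arcs, and neither can be entered or left backwards.
  residual : Digraph n → Digraph n
  residual F y z = (D y z ∧ not (F y z)) ∨ (F z y ∧ not (y == v0) ∧ not (z == v0))

  residual-cases : ∀ {F} y z → Arc (residual F) y z →
                   (Arc D y z × F y z ≡ false) ⊎ (Arc F z y × y ≢ v0 × z ≢ v0)
  residual-cases {F} y z r with ∨-true (D y z ∧ not (F y z)) r
  ... | inj₁ push = let Dyz , ¬Fyz = ∧-true push in inj₁ (Dyz , not≡true ¬Fyz)
  ... | inj₂ back = let Fzy , rest = ∧-true back ; y≠ , z≠ = ∧-true rest
                    in inj₂ (Fzy , ≢v0 y≠ , ≢v0 z≠)
    where
    ≢v0 : ∀ {x} → not (x == v0) ≡ true → x ≢ v0
    ≢v0 h refl = bool-clash (==-refl v0) (not≡true h)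

  residual-push : ∀ {F y z} → Arc D y z → F y z ≡ false → Arc (residual F) y z
  residual-push Dyz Fyz rewrite Dyz | Fyz = refl

  residual-back : ∀ {F y z} → Arc F z y → y ≢ v0 → z ≢ v0 → Arc (residual F) y z
  residual-back {F} {y} {z} Fzy y≢v0 z≢v0 rewrite Fzy | ==-false y≢v0 | ==-false z≢v0 =
    ∨-zeroʳ (D y z ∧ not (F y z))

  module Augmentation {F A : Digraph n} (flow : IsFlow F) (A⊆res : A ⊆ residual F)
                      (A-balanced : ∀ x → deg⁻ A x ≡ deg⁺ A x) (A-v0 : deg⁺ A v0 ≡ 1) where

    -- Push flow along the arcs that A traverses forwards, cancel it on those traversed backwards.
    push cancel augment : Digraph n
    push    y z = A y z ∧ D y z
    cancel  y z = A z y ∧ F y z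
    augment y z = (F y z ∧ not (A z y)) ∨ push y z

    private
      F-opposite : ∀ {y z} → Arc D z y → F y z ≡ false
      F-opposite Dzy = ¬-not λ Fyz → bool-clash (F⊆D flow Fyz) (oriented-opposite oriented Dzy)

      push-unused : ∀ y z → push y z ≡ true → F y z ≡ false
      push-unused y z p with ∧-true p
      ... | Ayz , Dyz with residual-cases {F} y z (A⊆res Ayz)
      ...   | inj₁ (_ , Fyz) = Fyz
      ...   | inj₂ (Fzy , _) = ⊥-elim (bool-clash Fzy (F-opposite Dyz))

      split-A : ∀ y z → 𝟙 (A y z) ≡ 𝟙 (push y z) + 𝟙 (cancel z y)
      split-A y z = 𝟙-partition (A y z) (D y z) (F z y) covered (∧-guarded-false (D y z) F-opposite)
        where
        covered : A y z ≡ true → D y z ∨ F z y ≡ true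
        covered Ayz with residual-cases {F} y z (A⊆res Ayz)
        ... | inj₁ (Dyz , _) rewrite Dyz = refl
        ... | inj₂ (Fzy , _) rewrite Fzy = ∨-zeroʳ (D y z)

      reroute : ∀ y z → 𝟙 (augment y z) + 𝟙 (cancel y z) ≡ 𝟙 (F y z) + 𝟙 (push y z)
      reroute y z = 𝟙-reroute (F y z) (A z y) (push y z) (push-unused y z)

      deg⁺-reroute : ∀ x → deg⁺ augment x + deg⁺ cancel x ≡ deg⁺ F x + deg⁺ push x
      deg⁺-reroute x = trans (sum-+-≗ (reroute x))
                             (∑-distrib-+ (λ z → 𝟙 (F x z)) (λ z → 𝟙 (push x z)))

      deg⁻-reroute : ∀ x → deg⁻ augment x + deg⁻ cancel x ≡ deg⁻ F x + deg⁻ push x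
      deg⁻-reroute x = trans (sum-+-≗ (λ y → reroute y x))
                             (∑-distrib-+ (λ y → 𝟙 (F y x)) (λ y → 𝟙 (push y x)))

      deg⁺-A : ∀ x → deg⁺ A x ≡ deg⁺ push x + deg⁻ cancel x
      deg⁺-A x = trans (sum-cong-≗ (split-A x))
                       (∑-distrib-+ (λ z → 𝟙 (push x z)) (λ z → 𝟙 (cancel z x)))

      deg⁻-A : ∀ x → deg⁻ A x ≡ deg⁻ push x + deg⁺ cancel x
      deg⁻-A x = trans (sum-cong-≗ λ y → split-A y x)
                       (∑-distrib-+ (λ y → 𝟙 (push y x)) (λ y → 𝟙 (cancel x y)))

      no-cancel-at-v0 : ∀ y → cancel v0 y ≡ false × cancel y v0 ≡ false
      no-cancel-at-v0 y = ∧-guarded-false (A y v0) into-v0 , ∧-guarded-false (A v0 y) out-of-v0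
        where
        into-v0 : A y v0 ≡ true → F v0 y ≡ false
        into-v0 Ayv0 with residual-cases {F} y v0 (A⊆res Ayv0)
        ... | inj₁ (Dyv0 , _)      = F-opposite Dyv0
        ... | inj₂ (_ , _ , v0≢v0) = ⊥-elim (v0≢v0 refl)
        out-of-v0 : A v0 y ≡ true → F y v0 ≡ false
        out-of-v0 Av0y with residual-cases {F} v0 y (A⊆res Av0y)
        ... | inj₁ (Dv0y , _)      = F-opposite Dv0y
        ... | inj₂ (_ , v0≢v0 , _) = ⊥-elim (v0≢v0 refl)

    augment-isFlow : IsFlow augment
    augment-isFlow = record
      { F⊆D       = λ {y} {z} h → case ∨-true (F y z ∧ not (A z y)) h of λ
                      { (inj₁ kept)   → F⊆D flow (proj₁ (∧-true kept))
                      ; (inj₂ pushed) → proj₂ (∧-true pushed) }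
      ; conserved = λ x x≢v0 → rebalance (deg⁻-reroute x) (deg⁺-reroute x) (deg⁻-A x) (deg⁺-A x)
                                         (conserved flow x x≢v0) (A-balanced x)
      }

    augment-value : deg⁺ augment v0 ≡ suc (deg⁺ F v0)
    augment-value = begin
      deg⁺ augment v0                          ≡⟨ +-identityʳ _ ⟨
      deg⁺ augment v0 + 0                      ≡⟨ cong (deg⁺ augment v0 +_) no-cancel-out ⟨
      deg⁺ augment v0 + deg⁺ cancel v0         ≡⟨ deg⁺-reroute v0 ⟩
      deg⁺ F v0 + deg⁺ push v0                 ≡⟨ cong (deg⁺ F v0 +_) push-v0 ⟩
      deg⁺ F v0 + 1                            ≡⟨ +-comm (deg⁺ F v0) 1 ⟩
      suc (deg⁺ F v0)                          ∎
      where
      open ≡-Reasoning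
      no-cancel-out : deg⁺ cancel v0 ≡ 0
      no-cancel-out = sum-zero λ y → cong 𝟙 (proj₁ (no-cancel-at-v0 y))
      push-v0 : deg⁺ push v0 ≡ 1
      push-v0 = begin
        deg⁺ push v0                           ≡⟨ +-identityʳ _ ⟨
        deg⁺ push v0 + 0                       ≡⟨ cong (deg⁺ push v0 +_) (sum-zero λ y → cong 𝟙 (proj₂ (no-cancel-at-v0 y))) ⟨
        deg⁺ push v0 + deg⁻ cancel v0          ≡⟨ deg⁺-A v0 ⟨
        deg⁺ A v0                              ≡⟨ A-v0 ⟩
        1                                      ∎

  out-neighbour-≢v0 : ∀ {y} → Arc D v0 y → y ≢ v0
  out-neighbour-≢v0 Dv0y refl = Oriented.noLoop oriented v0 Dv0y

  -- The cut separates the source side R, together with v0 as a source, from the rest,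
  -- which contains v0 as a sink.
  capacity : (Fin n → Bool) → ℕ
  capacity R = arcs D R (not ∘ R) + sum (λ y → 𝟙 (not (R y) ∧ D v0 y))

  module _ {F : Digraph n} (flow : IsFlow F) where

    flow-cycle : 1 ≤ deg⁺ F v0 → ∃ λ xs → IsCycleThrough F v0 xs
    flow-cycle pos with Reachability.cycle-or-closed F v0
    ... | inj₁ cycle  = cycle
    ... | inj₂ closed =
      ⊥-elim (<⇒≱ (≤-trans entering (≤-reflexive (flow-cut flow R reachable-v0))) (≤-reflexive leaving))
      where
      open Reachability F v0
      R : Fin n → Bool
      R = reachable
      x₁ : Fin n
      x₁ = proj₁ (sum-𝟙-pos (F v0) pos)
      Fv0x₁ : Arc F v0 x₁
      Fv0x₁ = proj₂ (sum-𝟙-pos (F v0) pos)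
      entering : 1 ≤ arcs F (not ∘ R) R
      entering = subst (_≤ arcs F (not ∘ R) R) (cong 𝟙 first-arc) (arc≤arcs F (not ∘ R) R v0 x₁)
        where
        first-arc : not (R v0) ∧ R x₁ ∧ F v0 x₁ ≡ true
        first-arc rewrite reachable-v0 | reachable-root Fv0x₁ (out-neighbour-≢v0 (F⊆D flow Fv0x₁)) | Fv0x₁ = refl
      leaving : arcs F R (not ∘ R) ≡ 0
      leaving = sum-zero λ x → sum-zero λ y → cong 𝟙 (no-exit x y)
        where
        no-exit : ∀ x y → R x ∧ not (R y) ∧ F x y ≡ false
        no-exit x y = ∧-guarded-false (R x) λ Rx → ∧-guarded-false (not (R y)) λ ¬Ry → exit Rx ¬Ry
          where
          exit : R x ≡ true → not (R y) ≡ true → F x y ≡ false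
          exit Rx ¬Ry = ¬-not λ Fxy → case y ≟ v0 of λ
            { (yes refl) → closed x Rx Fxy
            ; (no y≢v0)  → bool-clash (reachable-arc Rx Fxy y≢v0) (not≡true ¬Ry) }

    module MinCut (closed : ∀ x → Reachability.reachable (residual F) v0 x ≡ true →
                                  Arc (residual F) x v0 → ⊥) where
      open Reachability (residual F) v0
      R : Fin n → Bool
      R = reachable

      from-v0 : ∀ x → (d : Dec (v0 ≡ x)) →
                sum (λ y → 𝟙 (not (R x) ∧ R y ∧ F x y)) ≡ 𝟙 (does d) * sum (λ y → 𝟙 (R y ∧ F v0 y))
      from-v0 x (yes refl) rewrite reachable-v0 = sym (+-identityʳ _)
      from-v0 x (no v0≢x)  = sum-zero λ y → cong 𝟙 (∧-guarded-false (not (R x)) λ ¬Rx →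
                                                     ∧-guarded-false (R y) λ Ry → no-return ¬Rx Ry)
        where
        no-return : ∀ {y} → not (R x) ≡ true → R y ≡ true → F x y ≡ false
        no-return {y} ¬Rx Ry = ¬-not λ Fxy →
          bool-clash (reachable-arc Ry (residual-back {F} Fxy (reachable-≢v0 Ry) (v0≢x ∘ sym)) (v0≢x ∘ sym))
                     (not≡true ¬Rx)

      into-R : arcs F (not ∘ R) R ≡ sum (λ y → 𝟙 (R y ∧ F v0 y))
      into-R = trans (sum-cong-≗ λ x → from-v0 x (v0 ≟ x)) (sum-point v0 _)

      saturated-from-v0 : ∀ y → 𝟙 (not (R y) ∧ F v0 y) ≡ 𝟙 (not (R y) ∧ D v0 y)
      saturated-from-v0 y = cong 𝟙 (∧-guarded-cong (not (R y)) λ ¬Ry → ≡true-ext (F⊆D flow) (saturated ¬Ry))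
        where
        saturated : not (R y) ≡ true → Arc D v0 y → Arc F v0 y
        saturated ¬Ry Dv0y = ¬-not λ Fv0y →
          bool-clash (reachable-root (residual-push {F} Dv0y Fv0y) (out-neighbour-≢v0 Dv0y)) (not≡true ¬Ry)

      saturated-from-R : ∀ x y → 𝟙 (R x ∧ not (R y) ∧ F x y) ≡ 𝟙 (R x ∧ not (R y) ∧ D x y)
      saturated-from-R x y = cong 𝟙 (∧-guarded-cong (R x) λ Rx → ∧-guarded-cong (not (R y)) λ ¬Ry →
                                       ≡true-ext (F⊆D flow) (saturated Rx ¬Ry))
        where
        saturated : R x ≡ true → not (R y) ≡ true → Arc D x y → Arc F x y
        saturated Rx ¬Ry Dxy = ¬-not λ Fxy → case y ≟ v0 of λ
          { (yes refl) → closed x Rx (residual-push {F} Dxy Fxy)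
          ; (no y≢v0)  → bool-clash (reachable-arc Rx (residual-push {F} Dxy Fxy) y≢v0) (not≡true ¬Ry) }

      value≡capacity : deg⁺ F v0 ≡ capacity R
      value≡capacity = begin
        deg⁺ F v0
          ≡⟨ trans (sum-cong-≗ λ y → 𝟙-split (R y) (F v0 y)) (∑-distrib-+ (λ y → 𝟙 (R y ∧ F v0 y)) _) ⟩
        sum (λ y → 𝟙 (R y ∧ F v0 y)) + sum (λ y → 𝟙 (not (R y) ∧ F v0 y))
          ≡⟨ cong₂ _+_ (sym into-R) (sum-cong-≗ saturated-from-v0) ⟩
        arcs F (not ∘ R) R + sum (λ y → 𝟙 (not (R y) ∧ D v0 y))
          ≡⟨ cong (_+ sum (λ y → 𝟙 (not (R y) ∧ D v0 y))) (trans (flow-cut flow R reachable-v0)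
                (sum-cong-≗ λ x → sum-cong-≗ (saturated-from-R x))) ⟩
        capacity R ∎
        where open ≡-Reasoning

    augment-or-cut : (∃ λ F′ → IsFlow F′ × deg⁺ F′ v0 ≡ suc (deg⁺ F v0))
                   ⊎ (∃ λ R → R v0 ≡ false × deg⁺ F v0 ≡ capacity R)
    augment-or-cut with Reachability.cycle-or-closed (residual F) v0
    ... | inj₁ (xs , cycle) = inj₁ (augment , augment-isFlow , augment-value)
      where
      open Augmentation flow (onCycle⊆ cycle) (onCycle-balanced v0 (cycle-unique cycle))
                             (onCycle-deg⁺-v0 v0 (cycle-unique cycle))
    ... | inj₂ closed = inj₂ (_ , Reachability.reachable-v0 (residual F) v0 , MinCut.value≡capacity closed)

  decompose : ∀ j {F} → IsFlow F → j ≤ deg⁺ F v0 → DisjointCyclesThrough F v0 j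
  decompose zero    _    _   = no-cycles
  decompose (suc j) flow j< with flow-cycle flow (≤-trans (s≤s z≤n) j<)
  ... | xs , cycle = add-cycle remove⊆F cycle (removed ∘ onCycle-complete v0)
                               (decompose j remove-isFlow (s≤s⁻¹ (subst (suc j ≤_) remove-value j<)))
    where
    open Removal flow (onCycle⊆ cycle) (onCycle-balanced v0 (cycle-unique cycle))
                      (onCycle-deg⁺-v0 v0 (cycle-unique cycle))

  max-flow≥min-cut : ∀ k → (∀ R → R v0 ≡ false → k ≤ capacity R) → ∃ λ F → IsFlow F × k ≤ deg⁺ F v0
  max-flow≥min-cut k cut-bound = grow k ≤-refl
    where
    grow : ∀ j → j ≤ k → ∃ λ F → IsFlow F × j ≤ deg⁺ F v0
    grow zero    _    = _ , empty-isFlow , z≤n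
    grow (suc j) j<k with grow j (<⇒≤ j<k)
    ... | F , flow , j≤ with augment-or-cut flow
    ...   | inj₁ (F′ , flow′ , value′)     = F′ , flow′ , subst (suc j ≤_) (sym value′) (s≤s j≤)
    ...   | inj₂ (R , Rv0 , value≡capacity) =
      F , flow , ≤-trans j<k (subst (k ≤_) (sym value≡capacity) (cut-bound R Rv0))

  cut-bound⇒disjoint-cycles : ∀ k → (∀ R → R v0 ≡ false → k ≤ capacity R) → DisjointCyclesThrough D v0 k
  cut-bound⇒disjoint-cycles k cut-bound with max-flow≥min-cut k cut-bound
  ... | F , flow , k≤ = disjoint-mono (F⊆D flow) (decompose k flow k≤)

weighted-degree-bound : ∀ {k p q e C SO SI} → q ≤ p → e + C ≡ SO + SI → p * k ≤ SO →
  p * q * (2 * k) ≤ SO * q + p * SI + p * q → p * (k * (p + q)) ≤ p * (e + C + q)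
weighted-degree-bound {k} {p} {q} {e} {C} {SO} {SI} q≤p degree-sum out-sum pair-sum with m≤n⇒∃[o]m+o≡n q≤p
... | d , refl = begin
  (q + d) * (k * (q + d + q))                           ≡⟨ expand q d k ⟩
  d * ((q + d) * k) + (q + d) * q * (2 * k)             ≤⟨ +-mono-≤ (*-monoʳ-≤ d out-sum) pair-sum ⟩
  d * SO + (SO * q + (q + d) * SI + (q + d) * q)        ≡⟨ collect q d SO SI ⟩
  (q + d) * (SO + SI + q)                               ≡⟨ cong (λ t → (q + d) * (t + q)) degree-sum ⟨
  (q + d) * (e + C + q)                                 ∎
  where
  open ≤-Reasoning
  expand : ∀ q d k → (q + d) * (k * (q + d + q)) ≡ d * ((q + d) * k) + (q + d) * q * (2 * k)
  expand = solve-∀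
  collect : ∀ q d SO SI → d * SO + (SO * q + (q + d) * SI + (q + d) * q) ≡ (q + d) * (SO + SI + q)
  collect = solve-∀

-- k = d⁺(v0), p = |R ∩ N⁺(v0)|, q = |R ∩ N⁻(v0)|, C and e count the arcs leaving R and inside R,
-- and SO, SI are the sums of the out-degrees over R ∩ N⁺(v0) and R ∩ N⁻(v0).
counting-bound : ∀ {k p q C e SO SI} → q ≤ C → p ≤ k → e + C ≡ SO + SI →
  2 * e + (p + q) ≤ (p + q) * (p + q) → p * k ≤ SO → p * q * (2 * k) ≤ SO * q + p * SI + p * q → p ≤ C
counting-bound {k} {p} {q} {C} {e} {SO} {SI} q≤C p≤k degree-sum inside-bound out-sum pair-sum with p ≤? C
... | yes p≤C = p≤C
... | no  p≰C = ⊥-elim (n≮n (2 * (k * m)) (begin-strict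
    2 * (k * m)                <⟨ m<m+n (2 * (k * m)) (s≤s z≤n) ⟩
    2 * (k * m) + 2            ≡⟨ identity₁ (k * m) ⟩
    2 * (k * m + 1)            ≤⟨ *-monoʳ-≤ 2 (+-monoˡ-≤ 1 km≤) ⟩
    2 * (e + C + q + 1)        ≤⟨ *-monoʳ-≤ 2 (begin
                                    e + C + q + 1     ≡⟨ identity₂ e C q ⟩
                                    e + (suc C + q)   ≤⟨ +-monoʳ-≤ e (+-monoˡ-≤ q C<p) ⟩
                                    e + m             ∎) ⟩
    2 * (e + m)                ≡⟨ identity₃ e m ⟩
    2 * e + m + m              ≤⟨ +-monoˡ-≤ m inside-bound ⟩
    m * m + m                  ≡⟨ identity₄ m ⟩
    m * (m + 1)                ≤⟨ *-monoʳ-≤ m (begin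
                                    p + q + 1         ≡⟨ identity₅ p q ⟩
                                    p + suc q         ≤⟨ +-monoʳ-≤ p q<p ⟩
                                    p + p             ≤⟨ +-mono-≤ p≤k p≤k ⟩
                                    k + k             ∎) ⟩
    m * (k + k)                ≡⟨ identity₆ k m ⟩
    2 * (k * m)                ∎))
  where
  open ≤-Reasoning
  m : ℕ
  m = p + q
  C<p : C < p
  C<p = ≰⇒> p≰C
  q<p : q < p
  q<p = ≤-<-trans q≤C C<p
  km≤ : k * m ≤ e + C + q
  km≤ = *-cancelˡ-≤ p ⦃ >-nonZero (≤-<-trans z≤n q<p) ⦄
          (weighted-degree-bound {e = e} {C} (<⇒≤ q<p) degree-sum out-sum pair-sum)
  identity₁ : ∀ x → 2 * x + 2 ≡ 2 * (x + 1)
  identity₁ = solve-∀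
  identity₂ : ∀ e C q → e + C + q + 1 ≡ e + (suc C + q)
  identity₂ = solve-∀
  identity₃ : ∀ e m → 2 * (e + m) ≡ 2 * e + m + m
  identity₃ = solve-∀
  identity₄ : ∀ m → m * m + m ≡ m * (m + 1)
  identity₄ = solve-∀
  identity₅ : ∀ p q → p + q + 1 ≡ p + suc q
  identity₅ = solve-∀
  identity₆ : ∀ k m → m * (k + k) ≡ 2 * (k * m)
  identity₆ = solve-∀

module CutBound {n : ℕ} (D : Digraph n) (v0 : Fin n) (oriented : Oriented D) (dominating : Dominating D v0)
  (out-bound  : ∀ u → Arc D v0 u → deg⁺ D v0 ≤ deg⁺ D u)
  (pair-bound : ∀ u w → Arc D v0 u → Arc D w v0 → 2 * deg⁺ D v0 ≤ deg⁺ D u + deg⁺ D w + 1) where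

  open Flows D v0 oriented using (capacity)

  module _ (R : Fin n → Bool) (Rv0 : R v0 ≡ false) where

    private
      O I : Fin n → Bool
      O x = R x ∧ D v0 x
      I x = R x ∧ D x v0

      k p q N C e SO SI : ℕ
      k  = deg⁺ D v0
      p  = ∣ O ∣
      q  = ∣ I ∣
      N  = sum λ x → 𝟙 (not (R x) ∧ D v0 x)
      C  = arcs D R (not ∘ R)
      e  = arcs D R R
      SO = sum λ x → 𝟙 (O x) * deg⁺ D x
      SI = sum λ x → 𝟙 (I x) * deg⁺ D x

      𝟙-R-split : ∀ x → 𝟙 (R x) ≡ 𝟙 (O x) + 𝟙 (I x)
      𝟙-R-split x = 𝟙-partition (R x) (D v0 x) (D x v0) adjacent (oriented-asym oriented v0 x)
        where
        adjacent : R x ≡ true → D v0 x ∨ D x v0 ≡ true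
        adjacent Rx with dominating x (λ { refl → bool-clash Rx Rv0 })
        ... | inj₁ Dv0x rewrite Dv0x = refl
        ... | inj₂ Dxv0 rewrite Dxv0 = ∨-zeroʳ (D v0 x)

      q≤C : q ≤ C
      q≤C = sum-mono-≤ λ x → subst (λ b → 𝟙 (R x ∧ not b ∧ D x v0) ≤ sum (exits x)) Rv0 (≤-sum (exits x) v0)
        where
        exits : Fin n → Fin n → ℕ
        exits x y = 𝟙 (R x ∧ not (R y) ∧ D x y)

      p≤k : p ≤ k
      p≤k = sum-mono-≤ λ x → 𝟙-mono (proj₂ ∘ ∧-true {R x})

      degree-sum : e + C ≡ SO + SI
      degree-sum = begin
        e + C                                                ≡⟨ ∑-deg⁺-split D R R ⟨
        sum (λ x → 𝟙 (R x) * deg⁺ D x)                        ≡⟨ sum-cong-≗ split ⟩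
        sum (λ x → 𝟙 (O x) * deg⁺ D x + 𝟙 (I x) * deg⁺ D x)   ≡⟨ ∑-distrib-+ (weighted O) (weighted I) ⟩
        SO + SI                                              ∎
        where
        open ≡-Reasoning
        weighted : (Fin n → Bool) → Fin n → ℕ
        weighted S x = 𝟙 (S x) * deg⁺ D x
        split : ∀ x → 𝟙 (R x) * deg⁺ D x ≡ 𝟙 (O x) * deg⁺ D x + 𝟙 (I x) * deg⁺ D x
        split x = trans (cong (_* deg⁺ D x) (𝟙-R-split x)) (*-distribʳ-+ (deg⁺ D x) (𝟙 (O x)) (𝟙 (I x)))

      inside-bound : 2 * e + (p + q) ≤ (p + q) * (p + q)
      inside-bound = subst (λ m → 2 * e + m ≤ m * m)
                           (trans (sum-cong-≗ 𝟙-R-split) (∑-distrib-+ (𝟙 ∘ O) (𝟙 ∘ I)))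
                           (arcs-inside-bound oriented R)

      out-sum : p * k ≤ SO
      out-sum = begin
        p * k                        ≡⟨ *-distribʳ-sum k (𝟙 ∘ O) ⟩
        sum (λ x → 𝟙 (O x) * k)      ≤⟨ sum-mono-≤ (λ x → 𝟙*-mono (O x) (out-bound x ∘ proj₂ ∘ ∧-true)) ⟩
        SO                           ∎
        where open ≤-Reasoning

      pair-sum : p * q * (2 * k) ≤ SO * q + p * SI + p * q
      pair-sum = begin
        p * q * (2 * k)
          ≡⟨ cong (_* (2 * k)) (sum-product (𝟙 ∘ O) (𝟙 ∘ I)) ⟨
        sum (λ x → sum (both x)) * (2 * k)
          ≡⟨ trans (*-distribʳ-sum (2 * k) (λ x → sum (both x)))
                   (sum-cong-≗ λ x → *-distribʳ-sum (2 * k) (both x)) ⟩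
        sum (λ x → sum (λ y → both x y * (2 * k)))
          ≤⟨ sum-mono-≤ (λ x → sum-mono-≤ (pair x)) ⟩
        sum (λ x → sum (λ y → both x y * (deg⁺ D x + deg⁺ D y + 1)))
          ≡⟨ sum-cong-≗ (λ x → sum-cong-≗ λ y → expand (𝟙 (O x)) (𝟙 (I y)) (deg⁺ D x) (deg⁺ D y)) ⟩
        sum (λ x → sum (λ y → outer x y + inner x y + both x y))
          ≡⟨ trans (sum₂-distrib-+ (λ x y → outer x y + inner x y) both)
                   (cong (_+ sum (λ x → sum (both x))) (sum₂-distrib-+ outer inner)) ⟩
        sum (λ x → sum (outer x)) + sum (λ x → sum (inner x)) + sum (λ x → sum (both x))
          ≡⟨ cong₂ _+_ (cong₂ _+_ (sum-product (λ x → 𝟙 (O x) * deg⁺ D x) (𝟙 ∘ I))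
                                  (sum-product (𝟙 ∘ O) (λ y → 𝟙 (I y) * deg⁺ D y)))
                       (sum-product (𝟙 ∘ O) (𝟙 ∘ I)) ⟩
        SO * q + p * SI + p * q ∎
        where
        open ≤-Reasoning
        outer inner both : Fin n → Fin n → ℕ
        outer x y = 𝟙 (O x) * deg⁺ D x * 𝟙 (I y)
        inner x y = 𝟙 (O x) * (𝟙 (I y) * deg⁺ D y)
        both  x y = 𝟙 (O x) * 𝟙 (I y)
        expand : ∀ a b f g → a * b * (f + g + 1) ≡ a * f * b + a * (b * g) + a * b
        expand = solve-∀
        pair : ∀ x y → both x y * (2 * k) ≤ both x y * (deg⁺ D x + deg⁺ D y + 1)
        pair x y = subst (λ t → t * (2 * k) ≤ t * (deg⁺ D x + deg⁺ D y + 1)) (𝟙-∧ (O x) (I y))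
                         (𝟙*-mono (O x ∧ I y) λ OxIy →
                           let Ox , Iy = ∧-true {O x} OxIy
                           in pair-bound x y (proj₂ (∧-true {R x} Ox)) (proj₂ (∧-true {R y} Iy)))

    cut-bound : deg⁺ D v0 ≤ capacity R
    cut-bound = begin
      k      ≡⟨ trans (sum-cong-≗ λ x → 𝟙-split (R x) (D v0 x)) (∑-distrib-+ (𝟙 ∘ O) _) ⟩
      p + N  ≤⟨ +-monoˡ-≤ N (counting-bound q≤C p≤k degree-sum inside-bound out-sum pair-sum) ⟩
      C + N  ∎
      where open ≤-Reasoning

theorem2p1 : ∀ (n : ℕ) (D : Digraph n) (v0 : Fin n) →
    Oriented D → Dominating D v0 →
    (∀ u → Arc D v0 u → outdeg D v0 ≤ outdeg D u) →
    (∀ u w → Arc D v0 u → Arc D w v0 → 2 * outdeg D v0 ≤ outdeg D u + outdeg D w + 1) →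
    DisjointCyclesThrough D v0 (outdeg D v0)
theorem2p1 n D v0 oriented dominating out-bound pair-bound =
  subst (DisjointCyclesThrough D v0) (sym (outdeg≡deg⁺ D v0))
        (cut-bound⇒disjoint-cycles (deg⁺ D v0) cut-bound)
  where
  open Flows D v0 oriented using (cut-bound⇒disjoint-cycles)
  open CutBound D v0 oriented dominating
    (λ u Dv0u → subst₂ _≤_ (outdeg≡deg⁺ D v0) (outdeg≡deg⁺ D u) (out-bound u Dv0u))
    (λ u w Dv0u Dwv0 → subst₂ (λ a b → 2 * a ≤ b) (outdeg≡deg⁺ D v0)
                              (cong₂ (λ b c → b + c + 1) (outdeg≡deg⁺ D u) (outdeg≡deg⁺ D w))
                              (pair-bound u w Dv0u Dwv0))
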